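{- Let $k\geq 1$ be an integer, let $c>0$ and $A>0$, and let $0<p=p(n)<1$ satisfy $np\to\infty$ as $n\to\infty$. Then for all sufficiently large $n$ the following holds: if $G$ is a $(p,A\sqrt{pn})$-bijumbled graph on $n$ vertices, then for any disjoint $U,W\subseteq V(G)$ with $|U|=|W|\geq cn$ and $\delta(G[U,W])\geq p|U|/8$, the graph $G[U,W]$ contains a $k$-factor.
   Context: For a graph $G$ on $n$ vertices and disjoint $U,W\subseteq V(G)$, $e(U,W)$ is the number of edges of $G$ with one endpoint in $U$ and the other in $W$, and $G[U,W]$ is the bipartite graph on $U\cup W$ consisting of these edges. $G$ is $(p,\alpha)$-bijumbled if for all disjoint $U,W\subseteq V(G)$ we have $|e(U,W)-p|U||W||\leq \alpha\sqrt{|U||W|}$. A $k$-factor is a $k$-regular spanning subgraph. $\delta(\cdot)$ denotes minimum degree.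
   Formalization: The constants c and A and the values of the edge probability p(n) are rational. -}

module Defs where

open import Data.Nat as ℕ using (ℕ)
open import Data.Integer using (+_)
open import Data.Rational using (ℚ; _/_; _*_; _-_; _≤_; _<_)
open import Data.Bool using (Bool; true; false; if_then_else_)
open import Data.Fin using (Fin)
open import Data.Fin.Subset using (Subset; _∈_; _∩_; _∪_; ∣_∣)
open import Data.Vec using (tabulate; lookup; sum)
open import Data.Product using (_×_; ∃-syntax)
open import Data.Sum using (_⊎_)
open import Data.Empty using (⊥)
open import Relation.Binary.PropositionalEquality using (_≡_)

ℕ→ℚ : ℕ → ℚ
ℕ→ℚ n = + n / 1

record Graph (n : ℕ) : Set where
  field
    adj    : Fin n → Fin n → Bool
    sym    : ∀ u v → adj u v ≡ adj v u
    irrefl : ∀ u → adj u u ≡ false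
open Graph public

N : ∀ {n} → Graph n → Fin n → Subset n
N G u = tabulate (adj G u)

Disjoint : ∀ {n} → Subset n → Subset n → Set
Disjoint {n} U W = ∀ (x : Fin n) → x ∈ U → x ∈ W → ⊥

-- e(U,W): number of edges with one endpoint in U and the other in W
-- (for disjoint U, W each such edge is counted exactly once, from its U-end)
e : ∀ {n} → Graph n → Subset n → Subset n → ℕ
e G U W = sum (tabulate λ u → if lookup U u then ∣ W ∩ N G u ∣ else 0)

-- (p, α)-bijumbled, with α ≥ 0 given through α² = alpha2:
-- |e(U,W) − p|U||W|| ≤ α √(|U||W|)  ⇔  (e(U,W) − p|U||W|)² ≤ α² |U||W|
Bijumbled : ∀ {n} → Graph n → (p alpha2 : ℚ) → Set
Bijumbled {n} G p alpha2 =
  ∀ (U W : Subset n) → Disjoint U W →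
    let d = ℕ→ℚ (e G U W) - p * ℕ→ℚ ∣ U ∣ * ℕ→ℚ ∣ W ∣ in
    d * d ≤ alpha2 * ℕ→ℚ ∣ U ∣ * ℕ→ℚ ∣ W ∣

MinDegBipAtLeast : ∀ {n} → Graph n → Subset n → Subset n → ℚ → Set
MinDegBipAtLeast {n} G U W d =
  (∀ (u : Fin n) → u ∈ U → d ≤ ℕ→ℚ ∣ W ∩ N G u ∣) ×
  (∀ (w : Fin n) → w ∈ W → d ≤ ℕ→ℚ ∣ U ∩ N G w ∣)

record KFactor {n : ℕ} (k : ℕ) (G : Graph n) (U W : Subset n) : Set where
  field
    H     : Fin n → Fin n → Bool
    Hsym  : ∀ u v → H u v ≡ H v u
    Hsub  : ∀ u v → H u v ≡ true →
              (adj G u v ≡ true) × ((u ∈ U × v ∈ W) ⊎ (u ∈ W × v ∈ U))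
    Hreg  : ∀ (x : Fin n) → x ∈ U ∪ W → ∣ tabulate (H x) ∣ ≡ k

TendsToInfinity : (ℕ → ℚ) → Set
TendsToInfinity f = ∀ (M : ℚ) → ∃[ N₀ ] (∀ n → N₀ ℕ.≤ n → M ≤ f n)

{-# OPTIONS --safe #-}
-- A k-factor of G[U,W] is built one perfect matching at a time. Given a j-factor F with j < k, the
-- residual graph R = G[U,W] − F satisfies Hall's condition. A set X ⊆ U with |N_R(X)| < |X| ≤ m/16
-- would receive at least |X|(pm/8 − k) edges inside a set smaller than X, a discrepancy that
-- bijumbledness forbids (small sets expand). For larger X, put Z = W ∖ N_R(X): if Z is small, the same
-- argument from the W side gives |Z| ≤ |U ∖ X|, i.e. |X| ≤ |N_R(X)|; otherwise X and Z are both of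
-- linear size and span at most k|X| edges, again impossible once np is large. Hall's theorem then gives
-- a perfect matching of R, which extends F to a (j+1)-factor.

module Submission where

open import Data.Nat using (ℕ)
open import Data.Bool using (Bool)
open import Data.Fin using (Fin)
open import Defs using (Graph; adj)
open import Relation.Binary.PropositionalEquality using (_≡_)

module BoolFacts where

  open import Data.Bool using (Bool; true; false; _∧_; _∨_; not)
  open import Data.Fin using (Fin)
  open import Data.Fin.Properties using (_≟_)
  open import Data.Product using (_×_; _,_)
  open import Data.Sum using (_⊎_; inj₁; inj₂)
  open import Data.Empty using (⊥)
  open import Relation.Nullary using (does; yes)
  open import Relation.Nullary.Decidable using (dec-true)
  open import Relation.Binary.PropositionalEquality

  ∧-elim : ∀ {a b} → a ∧ b ≡ true → (a ≡ true) × (b ≡ true)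
  ∧-elim {true} {true} refl = refl , refl

  ∧-intro : ∀ {a b} → a ≡ true → b ≡ true → a ∧ b ≡ true
  ∧-intro refl refl = refl

  ∨-elim : ∀ {a b} → a ∨ b ≡ true → (a ≡ true) ⊎ (b ≡ true)
  ∨-elim {true} refl = inj₁ refl
  ∨-elim {false} {true} refl = inj₂ refl

  ∨-introˡ : ∀ {a} b → a ≡ true → a ∨ b ≡ true
  ∨-introˡ b refl = refl

  ∨-introʳ : ∀ a {b} → b ≡ true → a ∨ b ≡ true
  ∨-introʳ true refl = refl
  ∨-introʳ false refl = refl

  not-elim : ∀ {a} → not a ≡ true → a ≡ false
  not-elim {false} refl = refl

  not-intro : ∀ {a} → a ≡ false → not a ≡ true
  not-intro refl = refl

  true≢false : ∀ {a} → a ≡ true → a ≡ false → ⊥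
  true≢false refl ()

  bool-cases : ∀ (b : Bool) {P : Set} → (b ≡ true → P) → (b ≡ false → P) → P
  bool-cases true t f = t refl
  bool-cases false t f = f refl

  infix 7 _==_
  _==_ : ∀ {n} → Fin n → Fin n → Bool
  x == y = does (x ≟ y)

  ==-refl : ∀ {n} (x : Fin n) → x == x ≡ true
  ==-refl x = dec-true (x ≟ x) refl

  ==⇒≡ : ∀ {n} {x y : Fin n} → x == y ≡ true → x ≡ y
  ==⇒≡ {x = x} {y} e with x ≟ y
  ... | yes x≡y = x≡y

module Counting where

  open import Data.Nat
  open import Data.Nat.Properties
  open import Algebra.Properties.CommutativeSemigroup +-commutativeSemigroup using (interchange)
  open import Data.Bool using (Bool; true; false; _∧_; _∨_; not; if_then_else_)
  open import Data.Bool.Properties using (∧-zeroʳ; ∧-identityʳ)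
  open import Data.Fin using (Fin; zero; suc)
  import Data.Fin.Properties as Fin
  open import Data.Product using (Σ; _,_; proj₂)
  open import Data.Empty using (⊥-elim)
  open import Relation.Binary.PropositionalEquality
  open BoolFacts

  boolToℕ : Bool → ℕ
  boolToℕ true = 1
  boolToℕ false = 0

  count : ∀ {n} → (Fin n → Bool) → ℕ
  count {zero} f = 0
  count {suc n} f = boolToℕ (f zero) + count (λ i → f (suc i))

  _⊆ᵇ_ : ∀ {n} → (Fin n → Bool) → (Fin n → Bool) → Set
  _⊆ᵇ_ {n} f g = ∀ (i : Fin n) → f i ≡ true → g i ≡ true

  count-cong : ∀ {n} (f g : Fin n → Bool) → (∀ i → f i ≡ g i) → count f ≡ count g
  count-cong {zero} f g f≗g = refl
  count-cong {suc n} f g f≗g =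
    cong₂ _+_ (cong boolToℕ (f≗g zero)) (count-cong _ _ (λ i → f≗g (suc i)))

  boolToℕ-mono : ∀ a b → (a ≡ true → b ≡ true) → boolToℕ a ≤ boolToℕ b
  boolToℕ-mono true b a⇒b rewrite a⇒b refl = ≤-refl
  boolToℕ-mono false b a⇒b = z≤n

  count-mono : ∀ {n} (f g : Fin n → Bool) → f ⊆ᵇ g → count f ≤ count g
  count-mono {zero} f g f⊆g = z≤n
  count-mono {suc n} f g f⊆g =
    +-mono-≤ (boolToℕ-mono (f zero) (g zero) (f⊆g zero)) (count-mono _ _ (λ i → f⊆g (suc i)))

  count-mono-< : ∀ {n} (f g : Fin n → Bool) → f ⊆ᵇ g →
    (j : Fin n) → f j ≡ false → g j ≡ true → count f < count g
  count-mono-< {suc n} f g f⊆g zero fj gj rewrite fj | gj =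
    s≤s (count-mono _ _ (λ i → f⊆g (suc i)))
  count-mono-< {suc n} f g f⊆g (suc j) fj gj =
    +-mono-≤-< (boolToℕ-mono (f zero) (g zero) (f⊆g zero)) (count-mono-< _ _ (λ i → f⊆g (suc i)) j fj gj)

  count-⊆-≤⇒⊇ : ∀ {n} (f g : Fin n → Bool) → f ⊆ᵇ g → count g ≤ count f → g ⊆ᵇ f
  count-⊆-≤⇒⊇ f g f⊆g g≤f i gi with f i in fi
  ... | true = refl
  ... | false = ⊥-elim (<-irrefl refl (<-≤-trans (count-mono-< f g f⊆g i fi gi) g≤f))

  count-∨+count-∧ : ∀ {n} (f g : Fin n → Bool) →
    count (λ i → f i ∨ g i) + count (λ i → f i ∧ g i) ≡ count f + count g
  count-∨+count-∧ {zero} f g = refl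
  count-∨+count-∧ {suc n} f g = begin
    (boolToℕ (f zero ∨ g zero) + count f∨g′) + (boolToℕ (f zero ∧ g zero) + count f∧g′)
      ≡⟨ interchange (boolToℕ (f zero ∨ g zero)) (count f∨g′) (boolToℕ (f zero ∧ g zero)) (count f∧g′) ⟩
    (boolToℕ (f zero ∨ g zero) + boolToℕ (f zero ∧ g zero)) + (count f∨g′ + count f∧g′)
      ≡⟨ cong₂ _+_ (pointwise (f zero) (g zero)) (count-∨+count-∧ f′ g′) ⟩
    (boolToℕ (f zero) + boolToℕ (g zero)) + (count f′ + count g′)
      ≡⟨ interchange (boolToℕ (f zero)) (boolToℕ (g zero)) (count f′) (count g′) ⟩
    (boolToℕ (f zero) + count f′) + (boolToℕ (g zero) + count g′) ∎
    where
    open ≡-Reasoning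
    f′ g′ f∨g′ f∧g′ : Fin n → Bool
    f′ i = f (suc i)
    g′ i = g (suc i)
    f∨g′ i = f′ i ∨ g′ i
    f∧g′ i = f′ i ∧ g′ i
    pointwise : ∀ a b → boolToℕ (a ∨ b) + boolToℕ (a ∧ b) ≡ boolToℕ a + boolToℕ b
    pointwise true true = refl
    pointwise true false = refl
    pointwise false true = refl
    pointwise false false = refl

  count-∨ : ∀ {n} (f g : Fin n → Bool) → count (λ i → f i ∨ g i) ≤ count f + count g
  count-∨ f g = ≤-trans (m≤m+n _ _) (≤-reflexive (count-∨+count-∧ f g))

  count-∧+count-∧not : ∀ {n} (f g : Fin n → Bool) →
    count (λ i → f i ∧ g i) + count (λ i → f i ∧ not (g i)) ≡ count f
  count-∧+count-∧not {zero} f g = refl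
  count-∧+count-∧not {suc n} f g =
    trans (interchange (boolToℕ (f zero ∧ g zero)) (count (λ i → f (suc i) ∧ g (suc i)))
                        (boolToℕ (f zero ∧ not (g zero))) (count (λ i → f (suc i) ∧ not (g (suc i)))))
          (cong₂ _+_ (pointwise (f zero) (g zero)) (count-∧+count-∧not (λ i → f (suc i)) (λ i → g (suc i))))
    where
    pointwise : ∀ a b → boolToℕ (a ∧ b) + boolToℕ (a ∧ not b) ≡ boolToℕ a
    pointwise true true = refl
    pointwise true false = refl
    pointwise false b = refl

  count>0⇒∃ : ∀ {n} (f : Fin n → Bool) → 0 < count f → Σ (Fin n) (λ i → f i ≡ true)
  count>0⇒∃ {suc n} f pos with f zero in f0
  ... | true = zero , f0
  ... | false with count>0⇒∃ (λ i → f (suc i)) pos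
  ...   | i , fi = suc i , fi

  count-false : ∀ {n} (f : Fin n → Bool) → (∀ i → f i ≡ false) → count f ≡ 0
  count-false {zero} f f≡false = refl
  count-false {suc n} f f≡false rewrite f≡false zero = count-false _ (λ i → f≡false (suc i))

  count-unique : ∀ {n} (f : Fin n → Bool) (y : Fin n) → f y ≡ true →
    (∀ i → f i ≡ true → i ≡ y) → count f ≡ 1
  count-unique {suc n} f zero fy unique rewrite fy = cong suc (count-false _ others)
    where
    others : ∀ i → f (suc i) ≡ false
    others i with f (suc i) in fi
    ... | true with () ← unique (suc i) fi
    ... | false = refl
  count-unique {suc n} f (suc y) fy unique with f zero in f0
  ... | true with () ← unique zero f0
  ... | false = count-unique (λ i → f (suc i)) y fy (λ i fi → Fin.suc-injective (unique (suc i) fi))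

  count-∨-disjoint : ∀ {n} (f g : Fin n → Bool) → (∀ i → f i ∧ g i ≡ false) →
    count (λ i → f i ∨ g i) ≡ count f + count g
  count-∨-disjoint f g disjoint =
    trans (sym (+-identityʳ _))
          (trans (cong (count (λ i → f i ∨ g i) +_) (sym (count-false _ disjoint))) (count-∨+count-∧ f g))

  count-complement : ∀ {n} (X V : Fin n → Bool) → X ⊆ᵇ V → count X + count (λ i → V i ∧ not (X i)) ≡ count V
  count-complement X V X⊆V = trans (cong (_+ count (λ i → V i ∧ not (X i))) (sym (count-cong _ _ V∧X≗X)))
                                   (count-∧+count-∧not V X)
    where
    V∧X≗X : ∀ i → V i ∧ X i ≡ X i
    V∧X≗X i with X i in Xi
    ... | true = trans (∧-identityʳ (V i)) (X⊆V i Xi)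
    ... | false = ∧-zeroʳ (V i)

  count-singleton : ∀ {n} (u : Fin n) → count (λ x → x == u) ≡ 1
  count-singleton u = count-unique _ u (==-refl u) (λ i i≡u → ==⇒≡ i≡u)

  count-insert : ∀ {n} (X : Fin n → Bool) (u : Fin n) → X u ≡ false →
    count (λ x → X x ∨ x == u) ≡ suc (count X)
  count-insert X u Xu = begin
    count (λ x → X x ∨ x == u)      ≡⟨ count-∨-disjoint X (_== u) disjoint ⟩
    count X + count (λ x → x == u)  ≡⟨ cong (count X +_) (count-singleton u) ⟩
    count X + 1                     ≡⟨ +-comm (count X) 1 ⟩
    suc (count X)                   ∎
    where
    open ≡-Reasoning
    disjoint : ∀ x → X x ∧ x == u ≡ false
    disjoint x with x == u in x≡u
    ... | false = ∧-zeroʳ (X x)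
    ... | true = trans (∧-identityʳ (X x)) (subst (λ z → X z ≡ false) (sym (==⇒≡ x≡u)) Xu)

  count-remove : ∀ {n} (X : Fin n → Bool) (u : Fin n) → X u ≡ true →
    count X ≡ suc (count (λ x → X x ∧ not (x == u)))
  count-remove X u Xu =
    trans (sym (count-∧+count-∧not X (_== u)))
          (cong (_+ count (λ x → X x ∧ not (x == u)))
                (count-unique _ u (∧-intro Xu (==-refl u)) (λ i i∈ → ==⇒≡ (proj₂ (∧-elim {X i} i∈)))))

  Σᶠ : ∀ {n} → (Fin n → ℕ) → ℕ
  Σᶠ {zero} h = 0
  Σᶠ {suc n} h = h zero + Σᶠ (λ i → h (suc i))

  Σᶠ-cong : ∀ {n} (h h′ : Fin n → ℕ) → (∀ i → h i ≡ h′ i) → Σᶠ h ≡ Σᶠ h′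
  Σᶠ-cong {zero} h h′ h≗h′ = refl
  Σᶠ-cong {suc n} h h′ h≗h′ = cong₂ _+_ (h≗h′ zero) (Σᶠ-cong _ _ (λ i → h≗h′ (suc i)))

  Σᶠ-mono : ∀ {n} (h h′ : Fin n → ℕ) → (∀ i → h i ≤ h′ i) → Σᶠ h ≤ Σᶠ h′
  Σᶠ-mono {zero} h h′ h≤h′ = z≤n
  Σᶠ-mono {suc n} h h′ h≤h′ = +-mono-≤ (h≤h′ zero) (Σᶠ-mono _ _ (λ i → h≤h′ (suc i)))

  Σᶠ-mono-< : ∀ {n} (h h′ : Fin n → ℕ) → (∀ i → h i ≤ h′ i) → (j : Fin n) → h j < h′ j → Σᶠ h < Σᶠ h′
  Σᶠ-mono-< {suc n} h h′ h≤h′ zero hj<h′j = +-mono-<-≤ hj<h′j (Σᶠ-mono _ _ (λ i → h≤h′ (suc i)))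
  Σᶠ-mono-< {suc n} h h′ h≤h′ (suc j) hj<h′j =
    +-mono-≤-< (h≤h′ zero) (Σᶠ-mono-< _ _ (λ i → h≤h′ (suc i)) j hj<h′j)

  restrict : Bool → ℕ → ℕ
  restrict b x = if b then x else 0

  Σᶠ-restrict≤ : ∀ {n} (X : Fin n → Bool) (h : Fin n → ℕ) (k : ℕ) → (∀ i → X i ≡ true → h i ≤ k) →
    Σᶠ (λ i → restrict (X i) (h i)) ≤ count X * k
  Σᶠ-restrict≤ {zero} X h k h≤k = z≤n
  Σᶠ-restrict≤ {suc n} X h k h≤k with X zero in X0
  ... | true = +-mono-≤ (h≤k zero X0) (Σᶠ-restrict≤ _ _ k (λ i → h≤k (suc i)))
  ... | false = Σᶠ-restrict≤ _ _ k (λ i → h≤k (suc i))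

module Hall where

  open import Data.Nat
  open import Data.Nat.Properties
  open import Data.Bool using (Bool; true; false; _∧_; _∨_; not)
  open import Data.Bool.Properties using (∧-zeroʳ) renaming (_≟_ to _≟ᵇ_)
  open import Data.Fin using (Fin)
  open import Data.Fin.Properties using (any?) renaming (_≟_ to _≟ᶠ_)
  open import Data.Fin.Subset.Properties using (anySubset?)
  open import Data.Vec using (lookup; tabulate)
  open import Data.Vec.Properties using (lookup∘tabulate)
  open import Data.Product using (Σ; ∃; ∃-syntax; _×_; _,_; proj₁; proj₂)
  open import Data.Sum using (_⊎_; inj₁; inj₂)
  open import Data.Empty using (⊥; ⊥-elim)
  open import Function.Bundles using (mk⇔)
  open import Relation.Nullary using (¬_; Dec; does; yes; no; ¬?; _×-dec_)
  open import Relation.Nullary.Decidable using (dec-true; dec-false; does-⇔; decidable-stable)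
  open import Relation.Binary.PropositionalEquality
  open BoolFacts
  open Counting

  Relᵇ : ℕ → Set
  Relᵇ n = Fin n → Fin n → Bool

  neighbours : ∀ {n} → Relᵇ n → (Fin n → Bool) → Fin n → Bool
  neighbours R X y = does (any? λ x → X x ∧ R x y ≟ᵇ true)

  neighbours-intro : ∀ {n} (R : Relᵇ n) (X : Fin n → Bool) x y →
    X x ≡ true → R x y ≡ true → neighbours R X y ≡ true
  neighbours-intro R X x y Xx Rxy = dec-true (any? λ x → X x ∧ R x y ≟ᵇ true) (x , ∧-intro Xx Rxy)

  neighbours-elim : ∀ {n} (R : Relᵇ n) (X : Fin n → Bool) y → neighbours R X y ≡ true →
    Σ (Fin n) λ x → (X x ≡ true) × (R x y ≡ true)
  neighbours-elim R X y y∈ with any? (λ x → X x ∧ R x y ≟ᵇ true)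
  neighbours-elim R X y y∈ | yes (x , XRxy) = x , ∧-elim XRxy
  neighbours-elim R X y () | no _

  neighbours-cong : ∀ {n} (R : Relᵇ n) (X Y : Fin n → Bool) → (∀ i → X i ≡ Y i) →
    ∀ y → neighbours R X y ≡ neighbours R Y y
  neighbours-cong R X Y X≗Y y = does-⇔ (mk⇔ (transport X≗Y) (transport (λ i → sym (X≗Y i))))
    (any? λ x → X x ∧ R x y ≟ᵇ true) (any? λ x → Y x ∧ R x y ≟ᵇ true)
    where
    transport : ∀ {X Y : Fin _ → Bool} → (∀ i → X i ≡ Y i) →
      ∃ (λ x → X x ∧ R x y ≡ true) → ∃ (λ x → Y x ∧ R x y ≡ true)
    transport X≗Y (x , p) = x , subst (λ b → b ∧ R x y ≡ true) (X≗Y x) p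

  HallCondition : ∀ {n} → Relᵇ n → (Fin n → Bool) → Set
  HallCondition {n} R U = ∀ (X : Fin n → Bool) → X ⊆ᵇ U → count X ≤ count (neighbours R X)

  Violator : ∀ {n} → Relᵇ n → (Fin n → Bool) → (Fin n → Bool) → Set
  Violator R U X = X ⊆ᵇ U × count (neighbours R X) < count X

  hall? : ∀ {n} (R : Relᵇ n) (U : Fin n → Bool) → HallCondition R U ⊎ ∃ (Violator R U)
  hall? R U with anySubset? (λ V → count (neighbours R (restrictTo V)) <? count (restrictTo V))
    where
    restrictTo : _ → Fin _ → Bool
    restrictTo V i = lookup V i ∧ U i
  ... | yes (V , lt) = inj₂ (_ , (λ i i∈ → proj₂ (∧-elim i∈)) , lt)
  ... | no noViolator = inj₁ λ X X⊆U → ≮⇒≥ λ lt → noViolator (tabulate X , subst₂ _<_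
        (count-cong _ _ (neighbours-cong R _ _ (λ i → sym (restricted X X⊆U i))))
        (count-cong _ _ (λ i → sym (restricted X X⊆U i))) lt)
    where
    restricted : ∀ X → X ⊆ᵇ U → ∀ i → lookup (tabulate X) i ∧ U i ≡ X i
    restricted X X⊆U i rewrite lookup∘tabulate X i = bool-cases (X i)
      (λ Xi → subst (λ b → b ∧ U i ≡ b) (sym Xi) (X⊆U i Xi))
      (λ Xi → subst (λ b → b ∧ U i ≡ b) (sym Xi) refl)

  Between : ∀ {n} → Relᵇ n → (Fin n → Bool) → (Fin n → Bool) → Set
  Between {n} R U W = ∀ (x y : Fin n) → R x y ≡ true → (U x ≡ true) × (W y ≡ true)

  Functional : ∀ {n} → Relᵇ n → (Fin n → Bool) → Set
  Functional {n} R U = ∀ u (w₁ w₂ : Fin n) → U u ≡ true → R u w₁ ≡ true → R u w₂ ≡ true → w₁ ≡ w₂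

  record PerfectMatching {n} (R : Relᵇ n) (U W : Fin n → Bool) : Set where
    field
      M    : Relᵇ n
      M⊆R  : ∀ x y → M x y ≡ true → R x y ≡ true
      degᵁ : ∀ u → U u ≡ true → count (M u) ≡ 1
      degᵂ : ∀ w → W w ≡ true → count (λ u → M u w) ≡ 1

  PerfectMatching-mono : ∀ {n} {R R′ : Relᵇ n} {U W} → (∀ x y → R′ x y ≡ true → R x y ≡ true) →
    PerfectMatching R′ U W → PerfectMatching R U W
  PerfectMatching-mono R′⊆R P = record
    { M = M ; M⊆R = λ x y Mxy → R′⊆R x y (M⊆R x y Mxy) ; degᵁ = degᵁ ; degᵂ = degᵂ }
    where open PerfectMatching P

  module _ {n} (R : Relᵇ n) (U W : Fin n → Bool) (between : Between R U W) (hallR : HallCondition R U) where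

    hall-singleton : ∀ u → U u ≡ true → 1 ≤ count (neighbours R (_== u))
    hall-singleton u Uu = subst (_≤ count (neighbours R (_== u))) (count-singleton u)
      (hallR (_== u) (λ x x==u → subst (λ z → U z ≡ true) (sym (==⇒≡ x==u)) Uu))

    hall-successor : ∀ u → U u ≡ true → Σ (Fin n) λ y → R u y ≡ true
    hall-successor u Uu with count>0⇒∃ (neighbours R (_== u)) (hall-singleton u Uu)
    ... | y , y∈ with neighbours-elim R (_== u) y y∈
    ...   | x , x==u , Rxy = y , subst (λ z → R z y ≡ true) (==⇒≡ x==u) Rxy

    hall-predecessor : count W ≤ count U → ∀ w → W w ≡ true → Σ (Fin n) λ u → (U u ≡ true) × (R u w ≡ true)
    hall-predecessor W≤U w Ww = neighbours-elim R U w (W⊆NU w Ww)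
      where
      NU⊆W : neighbours R U ⊆ᵇ W
      NU⊆W y y∈ = let (x , _ , Rxy) = neighbours-elim R U y y∈ in proj₂ (between x y Rxy)
      W⊆NU : W ⊆ᵇ neighbours R U
      W⊆NU = count-⊆-≤⇒⊇ _ W NU⊆W (≤-trans W≤U (hallR U (λ _ Ux → Ux)))

    functional-injective : Functional R U → ∀ {u₁ u₂ w} → R u₁ w ≡ true → R u₂ w ≡ true → u₁ ≡ u₂
    functional-injective functional {u₁} {u₂} {w} Ru₁w Ru₂w with u₂ == u₁ in u₂==u₁
    ... | true = sym (==⇒≡ u₂==u₁)
    ... | false = ⊥-elim (<-irrefl refl (begin-strict
        1                                 <⟨ n<1+n 1 ⟩
        2                                 ≡⟨ cong suc (sym (count-singleton u₁)) ⟩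
        suc (count (_== u₁))              ≡⟨ sym (count-insert (_== u₁) u₂ u₂==u₁) ⟩
        count pair                        ≤⟨ hallR pair pair⊆U ⟩
        count (neighbours R pair)         ≤⟨ count-mono _ _ N⊆w ⟩
        count (_== w)                     ≡⟨ count-singleton w ⟩
        1                                 ∎))
      where
      open ≤-Reasoning
      pair : Fin n → Bool
      pair x = x == u₁ ∨ x == u₂
      pair-cases : ∀ x → pair x ≡ true → R x w ≡ true
      pair-cases x x∈ with ∨-elim {x == u₁} x∈
      ... | inj₁ x==u₁ = subst (λ z → R z w ≡ true) (sym (==⇒≡ x==u₁)) Ru₁w
      ... | inj₂ x==u₂ = subst (λ z → R z w ≡ true) (sym (==⇒≡ x==u₂)) Ru₂w
      pair⊆U : pair ⊆ᵇ U
      pair⊆U x x∈ = proj₁ (between x w (pair-cases x x∈))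
      N⊆w : neighbours R pair ⊆ᵇ (_== w)
      N⊆w y y∈ with neighbours-elim R pair y y∈
      ... | x , x∈ , Rxy = subst (λ z → y == z ≡ true)
            (functional x y w (pair⊆U x x∈) Rxy (pair-cases x x∈)) (==-refl y)

    functional⇒perfectMatching : count W ≤ count U → Functional R U → PerfectMatching R U W
    functional⇒perfectMatching W≤U functional = record
      { M = R ; M⊆R = λ _ _ Rxy → Rxy ; degᵁ = degᵁ ; degᵂ = degᵂ }
      where
      degᵁ : ∀ u → U u ≡ true → count (R u) ≡ 1
      degᵁ u Uu = let (y , Ruy) = hall-successor u Uu in
        count-unique (R u) y Ruy (λ i Rui → functional u i y Uu Rui Ruy)
      degᵂ : ∀ w → W w ≡ true → count (λ u → R u w) ≡ 1
      degᵂ w Ww = let (u , _ , Ruw) = hall-predecessor W≤U w Ww in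
        count-unique (λ z → R z w) u Ruw (λ i Riw → functional-injective functional Riw Ruw)

  deleteEdge : ∀ {n} → Relᵇ n → Fin n → Fin n → Relᵇ n
  deleteEdge R u w x y = R x y ∧ not (x == u ∧ y == w)

  deleteEdge-⊆ : ∀ {n} (R : Relᵇ n) u w x y → deleteEdge R u w x y ≡ true → R x y ≡ true
  deleteEdge-⊆ R u w x y e = proj₁ (∧-elim e)

  deleteEdge-keepsˡ : ∀ {n} (R : Relᵇ n) u w x y → x == u ≡ false → R x y ≡ true → deleteEdge R u w x y ≡ true
  deleteEdge-keepsˡ R u w x y x≠u Rxy rewrite x≠u | Rxy = refl

  deleteEdge-keepsʳ : ∀ {n} (R : Relᵇ n) u w x y → y == w ≡ false → R x y ≡ true → deleteEdge R u w x y ≡ true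
  deleteEdge-keepsʳ R u w x y y≠w Rxy rewrite y≠w | Rxy | ∧-zeroʳ (x == u) = refl

  edgeCount : ∀ {n} → Relᵇ n → ℕ
  edgeCount R = Σᶠ (λ x → count (R x))

  edgeCount-deleteEdge : ∀ {n} (R : Relᵇ n) u w → R u w ≡ true → edgeCount (deleteEdge R u w) < edgeCount R
  edgeCount-deleteEdge R u w Ruw =
    Σᶠ-mono-< _ _ (λ x → count-mono _ _ (deleteEdge-⊆ R u w x)) u
      (count-mono-< _ _ (deleteEdge-⊆ R u w u) w deleted Ruw)
    where
    deleted : deleteEdge R u w u w ≡ false
    deleted rewrite ==-refl u | ==-refl w = ∧-zeroʳ (R u w)

  between-deleteEdge : ∀ {n} {R : Relᵇ n} {U W u w} → Between R U W → Between (deleteEdge R u w) U W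
  between-deleteEdge {R = R} {u = u} {w} between x y e = between x y (deleteEdge-⊆ R u w x y e)

  edgeCount-deleteEdge≤ : ∀ {n fuel} (R : Relᵇ n) {u w} → R u w ≡ true → edgeCount R ≤ suc fuel →
    edgeCount (deleteEdge R u w) ≤ fuel
  edgeCount-deleteEdge≤ R {u} {w} Ruw bound = ≤-pred (<-≤-trans (edgeCount-deleteEdge R u w Ruw) bound)

  module _ {n} (R : Relᵇ n) (U : Fin n → Bool) (hallR : HallCondition R U) (u : Fin n) where

    violator-∋ : ∀ w X → Violator (deleteEdge R u w) U X → X u ≡ true
    violator-∋ w X (X⊆U , N<X) = bool-cases (X u) (λ Xu → Xu) λ Xu → ⊥-elim
      (<-irrefl refl (<-≤-trans N<X (≤-trans (hallR X X⊆U) (count-mono _ _ (N⊆N′ Xu)))))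
      where
      N⊆N′ : X u ≡ false → neighbours R X ⊆ᵇ neighbours (deleteEdge R u w) X
      N⊆N′ Xu y y∈ with neighbours-elim R X y y∈
      ... | x , Xx , Rxy = neighbours-intro (deleteEdge R u w) X x y Xx
              (deleteEdge-keepsˡ R u w x y (bool-cases (x == u)
                (λ x==u → ⊥-elim (true≢false (subst (λ z → X z ≡ true) (==⇒≡ x==u) Xx) Xu))
                (λ x≠u → x≠u)) Rxy)

    module DeletionViolator (w : Fin n) (X : Fin n → Bool) (violator : Violator (deleteEdge R u w) U X) where

      T A : Fin n → Bool
      T = neighbours (deleteEdge R u w) X
      A x = X x ∧ not (x == u)

      count-T≤count-A : count T ≤ count A
      count-T≤count-A =
        ≤-pred (subst (count T <_) (count-remove X u (violator-∋ w X violator)) (proj₂ violator))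

      A⊆U : A ⊆ᵇ U
      A⊆U x Ax = proj₁ violator x (proj₁ (∧-elim Ax))

      A-avoids-u : A u ≡ false
      A-avoids-u rewrite ==-refl u | ∧-zeroʳ (X u) = refl

      A-edges⊆T : ∀ x y → A x ≡ true → R x y ≡ true → T y ≡ true
      A-edges⊆T x y Ax Rxy = neighbours-intro (deleteEdge R u w) X x y (proj₁ (∧-elim Ax))
        (deleteEdge-keepsˡ R u w x y (not-elim (proj₂ (∧-elim {X x} Ax))) Rxy)

      u-edges⊆T : ∀ y → y == w ≡ false → R u y ≡ true → T y ≡ true
      u-edges⊆T y y≠w Ruy = neighbours-intro (deleteEdge R u w) X u y (violator-∋ w X violator)
        (deleteEdge-keepsʳ R u w u y y≠w Ruy)

    -- B = A₁ ∪ A₂ ∪ {u} and C = A₁ ∩ A₂ satisfy Hall's condition in R, but their neighbourhoods lie in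
    -- T₁ ∪ T₂ and T₁ ∩ T₂, whose sizes add up to at most |A₁| + |A₂| < |B| + |C|.
    module TwoViolators (Uu : U u ≡ true) {w₁ w₂} (w₁≢w₂ : w₁ ≢ w₂) {X₁ X₂}
      (violator₁ : Violator (deleteEdge R u w₁) U X₁) (violator₂ : Violator (deleteEdge R u w₂) U X₂) where

      module V₁ = DeletionViolator w₁ X₁ violator₁
      module V₂ = DeletionViolator w₂ X₂ violator₂
      open V₁ using () renaming (A to A₁; T to T₁)
      open V₂ using () renaming (A to A₂; T to T₂)

      B C : Fin n → Bool
      B x = (A₁ x ∨ A₂ x) ∨ x == u
      C x = A₁ x ∧ A₂ x

      count-B : count B ≡ suc (count (λ x → A₁ x ∨ A₂ x))
      count-B = count-insert (λ x → A₁ x ∨ A₂ x) u (cong₂ _∨_ V₁.A-avoids-u V₂.A-avoids-u)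

      B⊆U : B ⊆ᵇ U
      B⊆U x Bx with ∨-elim {A₁ x ∨ A₂ x} Bx
      ... | inj₂ x==u = subst (λ z → U z ≡ true) (sym (==⇒≡ x==u)) Uu
      ... | inj₁ A₁₂x with ∨-elim {A₁ x} A₁₂x
      ...   | inj₁ A₁x = V₁.A⊆U x A₁x
      ...   | inj₂ A₂x = V₂.A⊆U x A₂x

      C⊆U : C ⊆ᵇ U
      C⊆U x Cx = V₁.A⊆U x (proj₁ (∧-elim Cx))

      u-edges⊆T₁∪T₂ : ∀ y → R u y ≡ true → T₁ y ∨ T₂ y ≡ true
      u-edges⊆T₁∪T₂ y Ruy = bool-cases (y == w₁)
        (λ y==w₁ → ∨-introʳ (T₁ y) (V₂.u-edges⊆T y
          (dec-false (y ≟ᶠ w₂) (λ y≡w₂ → w₁≢w₂ (trans (sym (==⇒≡ y==w₁)) y≡w₂))) Ruy))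
        (λ y≠w₁ → ∨-introˡ (T₂ y) (V₁.u-edges⊆T y y≠w₁ Ruy))

      NB⊆T₁∪T₂ : neighbours R B ⊆ᵇ (λ y → T₁ y ∨ T₂ y)
      NB⊆T₁∪T₂ y y∈ with neighbours-elim R B y y∈
      ... | x , Bx , Rxy with ∨-elim {A₁ x ∨ A₂ x} Bx
      ...   | inj₂ x==u = u-edges⊆T₁∪T₂ y (subst (λ z → R z y ≡ true) (==⇒≡ x==u) Rxy)
      ...   | inj₁ A₁₂x with ∨-elim {A₁ x} A₁₂x
      ...     | inj₁ A₁x = ∨-introˡ (T₂ y) (V₁.A-edges⊆T x y A₁x Rxy)
      ...     | inj₂ A₂x = ∨-introʳ (T₁ y) (V₂.A-edges⊆T x y A₂x Rxy)

      NC⊆T₁∩T₂ : neighbours R C ⊆ᵇ (λ y → T₁ y ∧ T₂ y)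
      NC⊆T₁∩T₂ y y∈ with neighbours-elim R C y y∈
      ... | x , Cx , Rxy = ∧-intro (V₁.A-edges⊆T x y (proj₁ (∧-elim Cx)) Rxy)
                                   (V₂.A-edges⊆T x y (proj₂ (∧-elim {A₁ x} Cx)) Rxy)

      clash : ⊥
      clash = <-irrefl refl (begin-strict
        count A₁ + count A₂                                   <⟨ n<1+n _ ⟩
        suc (count A₁ + count A₂)                             ≡⟨ cong suc (sym (count-∨+count-∧ A₁ A₂)) ⟩
        suc (count (λ x → A₁ x ∨ A₂ x) + count C)             ≡⟨ cong (_+ count C) (sym count-B) ⟩
        count B + count C                                     ≤⟨ +-mono-≤ (hallR B B⊆U) (hallR C C⊆U) ⟩
        count (neighbours R B) + count (neighbours R C)       ≤⟨ +-mono-≤ (count-mono _ _ NB⊆T₁∪T₂)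
                                                                         (count-mono _ _ NC⊆T₁∩T₂) ⟩
        count (λ y → T₁ y ∨ T₂ y) + count (λ y → T₁ y ∧ T₂ y) ≡⟨ count-∨+count-∧ T₁ T₂ ⟩
        count T₁ + count T₂                                   ≤⟨ +-mono-≤ V₁.count-T≤count-A
                                                                         V₂.count-T≤count-A ⟩
        count A₁ + count A₂                                   ∎)
        where open ≤-Reasoning

    hall-deleteEdge : U u ≡ true → ∀ {w₁ w₂} → w₁ ≢ w₂ →
      HallCondition (deleteEdge R u w₁) U ⊎ HallCondition (deleteEdge R u w₂) U
    hall-deleteEdge Uu {w₁} {w₂} w₁≢w₂ with hall? (deleteEdge R u w₁) U | hall? (deleteEdge R u w₂) U
    ... | inj₁ hall₁ | _ = inj₁ hall₁
    ... | inj₂ _ | inj₁ hall₂ = inj₂ hall₂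
    ... | inj₂ (_ , violator₁) | inj₂ (_ , violator₂) =
      ⊥-elim (TwoViolators.clash Uu w₁≢w₂ violator₁ violator₂)

  Branching : ∀ {n} → Relᵇ n → (Fin n → Bool) → Set
  Branching R U = ∃[ u ] (U u ≡ true × ∃[ w₁ ] ∃[ w₂ ] (R u w₁ ≡ true × R u w₂ ≡ true × w₁ ≢ w₂))

  branching? : ∀ {n} (R : Relᵇ n) (U : Fin n → Bool) → Dec (Branching R U)
  branching? R U = any? λ u → (U u ≟ᵇ true) ×-dec any? λ w₁ → any? λ w₂ →
    (R u w₁ ≟ᵇ true) ×-dec (R u w₂ ≟ᵇ true) ×-dec ¬? (w₁ ≟ᶠ w₂)

  ¬branching⇒functional : ∀ {n} (R : Relᵇ n) U → ¬ Branching R U → Functional R U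
  ¬branching⇒functional R U ¬branching u w₁ w₂ Uu Ruw₁ Ruw₂ =
    decidable-stable (w₁ ≟ᶠ w₂) λ w₁≢w₂ → ¬branching (u , Uu , w₁ , w₂ , Ruw₁ , Ruw₂ , w₁≢w₂)

  -- Delete edges at branching vertices while Hall's condition survives; a minimal such relation is functional.
  hall : ∀ {n} (R : Relᵇ n) (U W : Fin n → Bool) → Between R U W → count W ≤ count U →
    HallCondition R U → PerfectMatching R U W
  hall {n} R₀ U W between₀ W≤U hall₀ = go (edgeCount R₀) R₀ between₀ hall₀ ≤-refl
    where
    go : ∀ fuel R → Between R U W → HallCondition R U → edgeCount R ≤ fuel → PerfectMatching R U W
    go fuel R between hallR bound with branching? R U
    go fuel R between hallR bound | no ¬branching =
      functional⇒perfectMatching R U W between hallR W≤U (¬branching⇒functional R U ¬branching)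
    go zero R between hallR bound | yes (u , Uu , w₁ , w₂ , Ruw₁ , Ruw₂ , w₁≢w₂) =
      ⊥-elim (n≮0 (<-≤-trans (edgeCount-deleteEdge R u w₁ Ruw₁) bound))
    go (suc fuel) R between hallR bound | yes (u , Uu , w₁ , w₂ , Ruw₁ , Ruw₂ , w₁≢w₂)
      with hall-deleteEdge R U hallR u Uu w₁≢w₂
    ... | inj₁ hall₁ = PerfectMatching-mono (deleteEdge-⊆ R u w₁)
            (go fuel (deleteEdge R u w₁) (between-deleteEdge between) hall₁
                (edgeCount-deleteEdge≤ R Ruw₁ bound))
    ... | inj₂ hall₂ = PerfectMatching-mono (deleteEdge-⊆ R u w₂)
            (go fuel (deleteEdge R u w₂) (between-deleteEdge between) hall₂
                (edgeCount-deleteEdge≤ R Ruw₂ bound))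


module RationalFacts where

  open import Data.Nat as ℕ using (ℕ; suc)
  import Data.Nat.Properties as ℕ
  open import Data.Integer as ℤ using (+_)
  import Data.Integer.Properties as ℤ
  import Data.Nat.Coprimality as Coprime
  open import Data.Rational
  open import Data.Rational.Properties
  open import Data.Rational.Solver
  open import Data.Sum using (_⊎_; inj₁; inj₂)
  open import Data.Product using (_×_; _,_; proj₁; proj₂)
  open import Data.Empty using (⊥)
  open import Relation.Binary.PropositionalEquality
  open import Defs using (ℕ→ℚ)
  open +-*-Solver

  ℕ→ℚ≡mkℚ : ∀ n → ℕ→ℚ n ≡ mkℚ (+ n) 0 (Coprime.sym (Coprime.1-coprimeTo n))
  ℕ→ℚ≡mkℚ n = normalize-coprime (Coprime.sym (Coprime.1-coprimeTo n))

  ℕ→ℚ-homo-+ : ∀ a b → ℕ→ℚ (a ℕ.+ b) ≡ ℕ→ℚ a + ℕ→ℚ b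
  ℕ→ℚ-homo-+ a b rewrite ℕ→ℚ≡mkℚ a | ℕ→ℚ≡mkℚ b = sym (/-cong {p₁ = + a ℤ.* + 1 ℤ.+ + b ℤ.* + 1} {q₁ = 1}
    (trans (cong₂ ℤ._+_ (ℤ.*-identityʳ (+ a)) (ℤ.*-identityʳ (+ b))) (sym (ℤ.pos-+ a b))) refl)

  ℕ→ℚ-homo-* : ∀ a b → ℕ→ℚ (a ℕ.* b) ≡ ℕ→ℚ a * ℕ→ℚ b
  ℕ→ℚ-homo-* a b rewrite ℕ→ℚ≡mkℚ a | ℕ→ℚ≡mkℚ b =
    sym (/-cong {p₁ = + a ℤ.* + b} {q₁ = 1} (sym (ℤ.pos-* a b)) refl)

  ℕ→ℚ-nonNeg : ∀ n → 0ℚ ≤ ℕ→ℚ n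
  ℕ→ℚ-nonNeg n = nonNegative⁻¹ (ℕ→ℚ n) {{normalize-nonNeg n 1}}

  ℕ→ℚ-pos : ∀ n → 0ℚ < ℕ→ℚ (suc n)
  ℕ→ℚ-pos n = positive⁻¹ (ℕ→ℚ (suc n)) {{normalize-pos (suc n) 1}}

  *-nonNeg : ∀ {x y} → 0ℚ ≤ x → 0ℚ ≤ y → 0ℚ ≤ x * y
  *-nonNeg {x} {y} 0≤x 0≤y =
    nonNegative⁻¹ (x * y) {{nonNeg*nonNeg⇒nonNeg x {{nonNegative 0≤x}} y {{nonNegative 0≤y}}}}

  *-pos : ∀ {x y} → 0ℚ < x → 0ℚ < y → 0ℚ < x * y
  *-pos {x} {y} 0<x 0<y = positive⁻¹ (x * y) {{pos*pos⇒pos x {{positive 0<x}} y {{positive 0<y}}}}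

  ≤-by-difference : ∀ {x y} (d : ℚ) → 0ℚ ≤ d → d ≡ y - x → x ≤ y
  ≤-by-difference {x} {y} d 0≤d d≡y-x = begin
    x           ≡⟨ sym (+-identityʳ x) ⟩
    x + 0ℚ      ≤⟨ +-monoʳ-≤ x 0≤d ⟩
    x + d       ≡⟨ cong (λ z → x + z) d≡y-x ⟩
    x + (y - x) ≡⟨ solve 2 (λ x y → x :+ (y :- x) := y) refl x y ⟩
    y           ∎
    where open ≤-Reasoning

  <-by-difference : ∀ {x y} (d : ℚ) → 0ℚ < d → d ≡ y - x → x < y
  <-by-difference {x} {y} d 0<d d≡y-x = begin-strict
    x           ≡⟨ sym (+-identityʳ x) ⟩
    x + 0ℚ      <⟨ +-monoʳ-< x 0<d ⟩
    x + d       ≡⟨ cong (λ z → x + z) d≡y-x ⟩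
    x + (y - x) ≡⟨ solve 2 (λ x y → x :+ (y :- x) := y) refl x y ⟩
    y           ∎
    where open ≤-Reasoning

  ≤⇒0≤- : ∀ {x y} → x ≤ y → 0ℚ ≤ y - x
  ≤⇒0≤- {x} {y} x≤y = begin
    0ℚ    ≡⟨ sym (+-inverseʳ x) ⟩
    x - x ≤⟨ +-monoˡ-≤ (- x) x≤y ⟩
    y - x ∎
    where open ≤-Reasoning

  ℕ→ℚ-mono-≤ : ∀ {a b} → a ℕ.≤ b → ℕ→ℚ a ≤ ℕ→ℚ b
  ℕ→ℚ-mono-≤ {a} {b} a≤b = ≤-by-difference (ℕ→ℚ (b ℕ.∸ a)) (ℕ→ℚ-nonNeg (b ℕ.∸ a)) (begin
    ℕ→ℚ (b ℕ.∸ a)                     ≡⟨ solve 2 (λ a d → d := a :+ d :- a) refl (ℕ→ℚ a) (ℕ→ℚ (b ℕ.∸ a)) ⟩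
    ℕ→ℚ a + ℕ→ℚ (b ℕ.∸ a) - ℕ→ℚ a     ≡⟨ cong (_- ℕ→ℚ a) (sym (ℕ→ℚ-homo-+ a (b ℕ.∸ a))) ⟩
    ℕ→ℚ (a ℕ.+ (b ℕ.∸ a)) - ℕ→ℚ a     ≡⟨ cong (λ z → ℕ→ℚ z - ℕ→ℚ a) (ℕ.m+[n∸m]≡n a≤b) ⟩
    ℕ→ℚ b - ℕ→ℚ a                     ∎)
    where open ≡-Reasoning

  ℕ→ℚ-≤-16* : ∀ {a b} → a ℕ.≤ 16 ℕ.* b → ℕ→ℚ a ≤ ℕ→ℚ 16 * ℕ→ℚ b
  ℕ→ℚ-≤-16* {a} {b} a≤16b = subst (ℕ→ℚ a ≤_) (ℕ→ℚ-homo-* 16 b) (ℕ→ℚ-mono-≤ a≤16b)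

  ℕ→ℚ-≤-/16 : ∀ {a b} → 16 ℕ.* a ℕ.≤ b → ℕ→ℚ a ≤ ℕ→ℚ b * (+ 1 / 16)
  ℕ→ℚ-≤-/16 {a} {b} 16a≤b = begin
    ℕ→ℚ a                          ≡⟨ solve 1 (λ a → a := con (ℕ→ℚ 16) :* a :* con (+ 1 / 16)) refl (ℕ→ℚ a) ⟩
    ℕ→ℚ 16 * ℕ→ℚ a * (+ 1 / 16)    ≡⟨ cong (_* (+ 1 / 16)) (sym (ℕ→ℚ-homo-* 16 a)) ⟩
    ℕ→ℚ (16 ℕ.* a) * (+ 1 / 16)    ≤⟨ *-monoʳ-≤-nonNeg (+ 1 / 16) (ℕ→ℚ-mono-≤ 16a≤b) ⟩
    ℕ→ℚ b * (+ 1 / 16)             ∎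
    where open ≤-Reasoning

  ℕ→ℚ-/16-≤ : ∀ {a b} → a ℕ.≤ 16 ℕ.* b → ℕ→ℚ a * (+ 1 / 16) ≤ ℕ→ℚ b
  ℕ→ℚ-/16-≤ {a} {b} a≤16b = begin
    ℕ→ℚ a * (+ 1 / 16)             ≤⟨ *-monoʳ-≤-nonNeg (+ 1 / 16) (ℕ→ℚ-≤-16* {a} {b} a≤16b) ⟩
    ℕ→ℚ 16 * ℕ→ℚ b * (+ 1 / 16)    ≡⟨ solve 1 (λ b → con (ℕ→ℚ 16) :* b :* con (+ 1 / 16) := b) refl (ℕ→ℚ b) ⟩
    ℕ→ℚ b                          ∎
    where open ≤-Reasoning

  square-mono-≤ : ∀ {x y} → 0ℚ ≤ x → x ≤ y → x * x ≤ y * y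
  square-mono-≤ {x} {y} 0≤x x≤y = begin
    x * x ≤⟨ *-monoʳ-≤-nonNeg x {{nonNegative 0≤x}} x≤y ⟩
    y * x ≤⟨ *-monoˡ-≤-nonNeg y {{nonNegative (≤-trans 0≤x x≤y)}} x≤y ⟩
    y * y ∎
    where open ≤-Reasoning

  square-nonNeg : ∀ x → 0ℚ ≤ x * x
  square-nonNeg x with ≤-total 0ℚ x
  ... | inj₁ 0≤x = *-nonNeg 0≤x 0≤x
  ... | inj₂ x≤0 = subst (0ℚ ≤_) (solve 1 (λ x → (:- x) :* (:- x) := x :* x) refl x)
                         (*-nonNeg (neg-antimono-≤ x≤0) (neg-antimono-≤ x≤0))

  discrepancy-bound-impossible : ∀ (D B a b δ : ℚ) → 0ℚ < a → 0ℚ < δ → 0ℚ ≤ B → 0ℚ ≤ b →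
    b ≤ ℕ→ℚ 16 * a → ℕ→ℚ 16 * B < δ * δ → (a * δ ≤ D ⊎ a * δ ≤ - D) → D * D ≤ B * a * b → ⊥
  discrepancy-bound-impossible D B a b δ 0<a 0<δ 0≤B 0≤b b≤16a 16B<δ² aδ≤∣D∣ D²≤Bab =
    <-irrefl refl (≤-<-trans D²≤Bab (begin-strict
      B * a * b             ≤⟨ *-monoˡ-≤-nonNeg (B * a) {{nonNegative (*-nonNeg 0≤B (<⇒≤ 0<a))}} b≤16a ⟩
      B * a * (ℕ→ℚ 16 * a)  ≡⟨ solve 3 (λ B a s → B :* a :* (s :* a) := a :* a :* (s :* B)) refl B a (ℕ→ℚ 16) ⟩
      a * a * (ℕ→ℚ 16 * B)  <⟨ *-monoʳ-<-pos (a * a) {{positive (*-pos 0<a 0<a)}} 16B<δ² ⟩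
      a * a * (δ * δ)       ≡⟨ solve 2 (λ a d → a :* a :* (d :* d) := a :* d :* (a :* d)) refl a δ ⟩
      a * δ * (a * δ)       ≤⟨ aδ²≤D² aδ≤∣D∣ ⟩
      D * D                 ∎))
    where
    open ≤-Reasoning
    0≤aδ : 0ℚ ≤ a * δ
    0≤aδ = <⇒≤ (*-pos 0<a 0<δ)
    aδ²≤D² : (a * δ ≤ D ⊎ a * δ ≤ - D) → a * δ * (a * δ) ≤ D * D
    aδ²≤D² (inj₁ aδ≤D) = square-mono-≤ 0≤aδ aδ≤D
    aδ²≤D² (inj₂ aδ≤-D) = ≤-trans (square-mono-≤ 0≤aδ aδ≤-D)
      (≤-reflexive (solve 1 (λ D → (:- D) :* (:- D) := D :* D) refl D))

  -- δ = pm/16 − k: every Hall violator forces a discrepancy of at least |X|δ.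
  slack : ℚ → ℚ → ℕ → ℚ
  slack p m k = p * m * (+ 1 / 16) - ℕ→ℚ k

  -- With h = s/2: h ≤ s − k ≤ δ, and h² − 256Qs = s(s − 1024Q)/4 > 0.
  slack-estimate : ∀ {k Q s δ : ℚ} → 0ℚ ≤ k → 0ℚ ≤ Q → ℕ→ℚ 2 * k + 1ℚ + ℕ→ℚ 1024 * Q ≤ s → s - k ≤ δ →
    0ℚ < δ × ℕ→ℚ 256 * Q * s < δ * δ
  slack-estimate {k} {Q} {s} {δ} 0≤k 0≤Q L≤s s-k≤δ = 0<δ , (begin-strict
    ℕ→ℚ 256 * Q * s  <⟨ <-by-difference (s * (s - ℕ→ℚ 1024 * Q) * ¼)
                          (*-pos (*-pos 0<s 0<s-1024Q) (positive⁻¹ ¼))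
                          (solve 2 (λ s Q → s :* (s :- con (ℕ→ℚ 1024) :* Q) :* con ¼
                                          := s :* con ½ :* (s :* con ½) :- con (ℕ→ℚ 256) :* Q :* s) refl s Q) ⟩
    h * h            ≤⟨ square-mono-≤ (<⇒≤ 0<h) h≤δ ⟩
    δ * δ            ∎)
    where
    open ≤-Reasoning
    ¼ : ℚ
    ¼ = + 1 / 4
    L h : ℚ
    L = ℕ→ℚ 2 * k + 1ℚ + ℕ→ℚ 1024 * Q
    h = s * ½
    0≤1024Q : 0ℚ ≤ ℕ→ℚ 1024 * Q
    0≤1024Q = *-nonNeg (ℕ→ℚ-nonNeg 1024) 0≤Q
    0<s : 0ℚ < s
    0<s = <-≤-trans (<-by-difference (1ℚ + (ℕ→ℚ 2 * k + ℕ→ℚ 1024 * Q))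
            (+-mono-<-≤ (positive⁻¹ 1ℚ) (+-mono-≤ (*-nonNeg (ℕ→ℚ-nonNeg 2) 0≤k) 0≤1024Q))
            (solve 2 (λ k Q → con 1ℚ :+ (con (ℕ→ℚ 2) :* k :+ con (ℕ→ℚ 1024) :* Q)
                           := con (ℕ→ℚ 2) :* k :+ con 1ℚ :+ con (ℕ→ℚ 1024) :* Q :- con 0ℚ) refl k Q)) L≤s
    0<s-1024Q : 0ℚ < s - ℕ→ℚ 1024 * Q
    0<s-1024Q = <-≤-trans (+-mono-<-≤ (positive⁻¹ 1ℚ) (*-nonNeg (ℕ→ℚ-nonNeg 2) 0≤k))
      (≤-by-difference (s - L) (≤⇒0≤- L≤s)
        (solve 3 (λ s k Q → s :- (con (ℕ→ℚ 2) :* k :+ con 1ℚ :+ con (ℕ→ℚ 1024) :* Q)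
                         := s :- con (ℕ→ℚ 1024) :* Q :- (con 1ℚ :+ con (ℕ→ℚ 2) :* k)) refl s k Q))
    0<h : 0ℚ < h
    0<h = *-pos 0<s (positive⁻¹ ½)
    h≤δ : h ≤ δ
    h≤δ = ≤-by-difference ((δ - (s - k)) + (s - L) * ½ + (½ + ℕ→ℚ 512 * Q))
      (+-mono-≤ (+-mono-≤ (≤⇒0≤- s-k≤δ) (*-nonNeg (≤⇒0≤- L≤s) (nonNegative⁻¹ ½)))
                (+-mono-≤ (nonNegative⁻¹ ½) (*-nonNeg (ℕ→ℚ-nonNeg 512) 0≤Q)))
      (solve 4 (λ s k Q δ → (δ :- (s :- k))
                            :+ (s :- (con (ℕ→ℚ 2) :* k :+ con 1ℚ :+ con (ℕ→ℚ 1024) :* Q)) :* con ½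
                            :+ (con ½ :+ con (ℕ→ℚ 512) :* Q)
                            := δ :- s :* con ½) refl s k Q δ)
    0<δ : 0ℚ < δ
    0<δ = <-≤-trans 0<h h≤δ

  -- M = 16L/c with L = 2k + 1 + 1024A²/c, so that np ≥ M makes s = cnp/16 ≥ L in slack-estimate.
  threshold : ℚ → ℚ → ℕ → ℚ
  threshold c⁻¹ A k = ℕ→ℚ 16 * ((ℕ→ℚ 2 * ℕ→ℚ k + 1ℚ + ℕ→ℚ 1024 * (A * A * c⁻¹)) * c⁻¹)

  slack-from-threshold : ∀ (c c⁻¹ A p n m : ℚ) (k : ℕ) → c * c⁻¹ ≡ 1ℚ → 0ℚ ≤ c → 0ℚ ≤ c⁻¹ → 0ℚ ≤ p →
    threshold c⁻¹ A k ≤ n * p → c * n ≤ m →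
    0ℚ < slack p m k × ℕ→ℚ 16 * (A * A * p * n) < slack p m k * slack p m k
  slack-from-threshold c c⁻¹ A p n m k cc⁻¹≡1 0≤c 0≤c⁻¹ 0≤p M≤np cn≤m =
    proj₁ estimate , subst (_< slack p m k * slack p m k) 256Qs≡16A²pn (proj₂ estimate)
    where
    open ≤-Reasoning
    1/16 : ℚ
    1/16 = + 1 / 16
    Q s L : ℚ
    Q = A * A * c⁻¹
    s = c * (n * p) * 1/16
    L = ℕ→ℚ 2 * ℕ→ℚ k + 1ℚ + ℕ→ℚ 1024 * Q
    L≤s : L ≤ s
    L≤s = begin
      L                             ≡⟨ sym (*-identityˡ L) ⟩
      1ℚ * L                        ≡⟨ cong (_* L) (sym cc⁻¹≡1) ⟩
      c * c⁻¹ * L                   ≡⟨ solve 3 (λ c c⁻¹ L → c :* c⁻¹ :* L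
                                                          := c :* (con (ℕ→ℚ 16) :* (L :* c⁻¹)) :* con 1/16)
                                         refl c c⁻¹ L ⟩
      c * threshold c⁻¹ A k * 1/16  ≤⟨ *-monoʳ-≤-nonNeg 1/16 (*-monoˡ-≤-nonNeg c {{nonNegative 0≤c}} M≤np) ⟩
      s                             ∎
    s-k≤δ : s - ℕ→ℚ k ≤ slack p m k
    s-k≤δ = +-monoˡ-≤ (- ℕ→ℚ k) (*-monoʳ-≤-nonNeg 1/16 (begin
      c * (n * p) ≡⟨ solve 3 (λ c n p → c :* (n :* p) := p :* (c :* n)) refl c n p ⟩
      p * (c * n) ≤⟨ *-monoˡ-≤-nonNeg p {{nonNegative 0≤p}} cn≤m ⟩
      p * m       ∎))
    estimate : 0ℚ < slack p m k × ℕ→ℚ 256 * Q * s < slack p m k * slack p m k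
    estimate = slack-estimate {ℕ→ℚ k} {Q} {s} (ℕ→ℚ-nonNeg k) (*-nonNeg (square-nonNeg A) 0≤c⁻¹) L≤s s-k≤δ
    256Qs≡16A²pn : ℕ→ℚ 256 * Q * s ≡ ℕ→ℚ 16 * (A * A * p * n)
    256Qs≡16A²pn = begin-equality
      ℕ→ℚ 256 * Q * s                        ≡⟨ solve 5 (λ A c c⁻¹ n p →
                                                     con (ℕ→ℚ 256) :* (A :* A :* c⁻¹)
                                                       :* (c :* (n :* p) :* con 1/16)
                                                     := c :* c⁻¹ :* (con (ℕ→ℚ 16) :* (A :* A :* p :* n)))
                                                   refl A c c⁻¹ n p ⟩
      c * c⁻¹ * (ℕ→ℚ 16 * (A * A * p * n))   ≡⟨ cong (_* (ℕ→ℚ 16 * (A * A * p * n))) cc⁻¹≡1 ⟩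
      1ℚ * (ℕ→ℚ 16 * (A * A * p * n))        ≡⟨ *-identityˡ (ℕ→ℚ 16 * (A * A * p * n)) ⟩
      ℕ→ℚ 16 * (A * A * p * n)               ∎

module Expansion where

  open import Data.Nat as ℕ using (ℕ; zero; suc)
  import Data.Nat.Properties as ℕ
  open import Data.Integer using (+_)
  open import Data.Rational
  open import Data.Rational.Properties
  open import Data.Rational.Solver
  open import Data.Bool using (Bool; true; false; _∧_)
  open import Data.Fin using (Fin)
  import Data.Fin as Fin
  open import Data.Product using (_×_; _,_; proj₁; proj₂)
  open import Data.Sum using (inj₁; inj₂)
  open import Data.Empty using (⊥)
  open import Relation.Binary.PropositionalEquality
  open import Defs using (ℕ→ℚ; Graph; adj)
  open BoolFacts
  open Counting
  open Hall
  open RationalFacts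
  open +-*-Solver

  degreeInto : ∀ {n} → Graph n → (Fin n → Bool) → Fin n → ℕ
  degreeInto G T x = count (λ y → T y ∧ adj G x y)

  edgesBetween : ∀ {n} → Graph n → (Fin n → Bool) → (Fin n → Bool) → ℕ
  edgesBetween G X Y = Σᶠ (λ x → restrict (X x) (degreeInto G Y x))

  discrepancy : ∀ {n} → Graph n → ℚ → (Fin n → Bool) → (Fin n → Bool) → ℚ
  discrepancy G p X Y = ℕ→ℚ (edgesBetween G X Y) - p * ℕ→ℚ (count X) * ℕ→ℚ (count Y)

  Disjointᵇ : ∀ {n} → (Fin n → Bool) → (Fin n → Bool) → Set
  Disjointᵇ {n} X Y = ∀ (x : Fin n) → X x ≡ true → Y x ≡ true → ⊥

  Jumbled : ∀ {n} → Graph n → ℚ → ℚ → Set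
  Jumbled {n} G p B = ∀ (X Y : Fin n → Bool) → Disjointᵇ X Y →
    discrepancy G p X Y * discrepancy G p X Y ≤ B * ℕ→ℚ (count X) * ℕ→ℚ (count Y)

  MinDegree : ∀ {n} → Graph n → (Fin n → Bool) → (Fin n → Bool) → ℚ → Set
  MinDegree {n} G S T d = ∀ (x : Fin n) → S x ≡ true → d ≤ ℕ→ℚ (degreeInto G T x)

  SmallSetsExpand : ∀ {n} → Graph n → ℕ → ℕ → (Fin n → Bool) → (Fin n → Bool) → Set
  SmallSetsExpand {n} G k m S T = ∀ (Q : Relᵇ n) →
    (∀ x y → Q x y ≡ true → (T y ≡ true) × (adj G x y ≡ true)) →
    (∀ x → S x ≡ true → degreeInto G T x ℕ.≤ count (Q x) ℕ.+ k) →
    ∀ X → X ⊆ᵇ S → 16 ℕ.* count X ℕ.≤ m → count X ℕ.≤ count (neighbours Q X)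

  LargeSetsAdjacent : ∀ {n} → Graph n → ℕ → ℕ → Set
  LargeSetsAdjacent {n} G k m = ∀ (X Z : Fin n → Bool) → Disjointᵇ X Z →
    (∀ x → X x ≡ true → degreeInto G Z x ℕ.≤ k) →
    m ℕ.≤ 16 ℕ.* count X → m ℕ.≤ 16 ℕ.* count Z → count Z ℕ.≤ m → count X ≡ 0

  Σᶠ-restrict≥ : ∀ {n} (X : Fin n → Bool) (h : Fin n → ℕ) (q : ℚ) → (∀ i → X i ≡ true → q ≤ ℕ→ℚ (h i)) →
    ℕ→ℚ (count X) * q ≤ ℕ→ℚ (Σᶠ (λ i → restrict (X i) (h i)))
  Σᶠ-restrict≥ {zero} X h q q≤h = ≤-reflexive (*-zeroˡ q)
  Σᶠ-restrict≥ {suc n} X h q q≤h with X Fin.zero in X0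
  ... | false = Σᶠ-restrict≥ (λ i → X (Fin.suc i)) (λ i → h (Fin.suc i)) q (λ i → q≤h (Fin.suc i))
  ... | true = begin
    ℕ→ℚ (suc (count X′)) * q                       ≡⟨ cong (_* q) (ℕ→ℚ-homo-+ 1 (count X′)) ⟩
    (1ℚ + ℕ→ℚ (count X′)) * q                       ≡⟨ solve 2 (λ c q → (con 1ℚ :+ c) :* q := q :+ c :* q)
                                                          refl (ℕ→ℚ (count X′)) q ⟩
    q + ℕ→ℚ (count X′) * q                          ≤⟨ +-mono-≤ (q≤h Fin.zero X0)
                                                          (Σᶠ-restrict≥ X′ h′ q (λ i → q≤h (Fin.suc i))) ⟩
    ℕ→ℚ (h Fin.zero) + ℕ→ℚ (Σᶠ restricted′)         ≡⟨ sym (ℕ→ℚ-homo-+ (h Fin.zero) (Σᶠ restricted′)) ⟩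
    ℕ→ℚ (h Fin.zero ℕ.+ Σᶠ restricted′)             ∎
    where
    open ≤-Reasoning
    X′ : Fin n → Bool
    X′ i = X (Fin.suc i)
    h′ restricted′ : Fin n → ℕ
    h′ i = h (Fin.suc i)
    restricted′ i = restrict (X′ i) (h′ i)

  module _ {n} (G : Graph n) (p B : ℚ) (k m : ℕ) (0<p : 0ℚ < p) (0≤B : 0ℚ ≤ B)
           (0<δ : 0ℚ < slack p (ℕ→ℚ m) k) (16B<δ² : ℕ→ℚ 16 * B < slack p (ℕ→ℚ m) k * slack p (ℕ→ℚ m) k)
           (jumbled : Jumbled G p B) where

    private
      δ d K : ℚ
      δ = slack p (ℕ→ℚ m) k
      d = p * ℕ→ℚ m * (+ 1 / 8)
      K = ℕ→ℚ k

    -- A violator X sends at least |X|(d − k) edges into N_Q(X), which is smaller than X, while the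
    -- expected number p|X||N_Q(X)| is at most p|X|m/16: the discrepancy exceeds |X|δ.
    small-sets-expand : ∀ {S T} → Disjointᵇ S T → MinDegree G S T d → SmallSetsExpand G k m S T
    small-sets-expand {S} {T} S∩T=∅ minDegree Q Q⊆G[S,T] loss X X⊆S 16a≤m = ℕ.≮⇒≥ λ b<a →
      discrepancy-bound-impossible D B (ℕ→ℚ a) (ℕ→ℚ b) δ (0<a b<a) 0<δ 0≤B (ℕ→ℚ-nonNeg b)
        (ℕ→ℚ-≤-16* {b} {a} (ℕ.≤-trans (ℕ.<⇒≤ b<a) (ℕ.m≤n*m a 16))) 16B<δ² (inj₁ (aδ≤D b<a)) (jumbled X Y X∩Y=∅)
      where
      Y : Fin n → Bool
      Y = neighbours Q X
      a b : ℕ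
      a = count X
      b = count Y
      D : ℚ
      D = discrepancy G p X Y
      0<a : b ℕ.< a → 0ℚ < ℕ→ℚ a
      0<a b<a = <-≤-trans (ℕ→ℚ-pos b) (ℕ→ℚ-mono-≤ b<a)
      X∩Y=∅ : Disjointᵇ X Y
      X∩Y=∅ x Xx Yx = let (z , _ , Qzx) = neighbours-elim Q X x Yx in
        S∩T=∅ x (X⊆S x Xx) (proj₁ (Q⊆G[S,T] z x Qzx))
      degree≥ : ∀ x → X x ≡ true → d - K ≤ ℕ→ℚ (degreeInto G Y x)
      degree≥ x Xx = ≤-by-difference (ℕ→ℚ (degreeInto G Y x) + K - d)
        (≤⇒0≤- (≤-trans (minDegree x (X⊆S x Xx))
          (subst (ℕ→ℚ (degreeInto G T x) ≤_) (ℕ→ℚ-homo-+ (degreeInto G Y x) k)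
            (ℕ→ℚ-mono-≤ (ℕ.≤-trans (loss x (X⊆S x Xx)) (ℕ.+-monoˡ-≤ k (count-mono (Q x) _ Qx⊆Y)))))))
        (solve 3 (λ e K d → e :+ K :- d := e :- (d :- K)) refl (ℕ→ℚ (degreeInto G Y x)) K d)
        where
        Qx⊆Y : Q x ⊆ᵇ (λ y → Y y ∧ adj G x y)
        Qx⊆Y y Qxy = ∧-intro (neighbours-intro Q X x y Xx Qxy) (proj₂ (Q⊆G[S,T] x y Qxy))
      aδ≤D : b ℕ.< a → ℕ→ℚ a * δ ≤ D
      aδ≤D b<a = ≤-by-difference
        ((ℕ→ℚ (edgesBetween G X Y) - ℕ→ℚ a * (d - K)) + ℕ→ℚ a * p * (ℕ→ℚ m * (+ 1 / 16) - ℕ→ℚ b))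
        (+-mono-≤ (≤⇒0≤- (Σᶠ-restrict≥ X (degreeInto G Y) (d - K) degree≥))
                  (*-nonNeg (*-nonNeg (<⇒≤ (0<a b<a)) (<⇒≤ 0<p))
                            (≤⇒0≤- (ℕ→ℚ-≤-/16 {b} {m} (ℕ.≤-trans (ℕ.*-monoʳ-≤ 16 (ℕ.<⇒≤ b<a)) 16a≤m)))))
        (solve 6 (λ e a b p m K → (e :- a :* (p :* m :* con (+ 1 / 8) :- K))
                                  :+ a :* p :* (m :* con (+ 1 / 16) :- b)
                                  := (e :- p :* a :* b) :- a :* (p :* m :* con (+ 1 / 16) :- K))
                 refl (ℕ→ℚ (edgesBetween G X Y)) (ℕ→ℚ a) (ℕ→ℚ b) p (ℕ→ℚ m) K)

    -- At most k|X| edges run between X and Z, against an expected p|X||Z| ≥ p|X|m/16.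
    large-sets-adjacent : LargeSetsAdjacent G k m
    large-sets-adjacent X Z X∩Z=∅ sparse m≤16a m≤16b b≤m = ℕ.n≤0⇒n≡0 (ℕ.≮⇒≥ λ 0<a →
      discrepancy-bound-impossible D B (ℕ→ℚ a) (ℕ→ℚ b) δ (<-≤-trans (ℕ→ℚ-pos 0) (ℕ→ℚ-mono-≤ 0<a)) 0<δ 0≤B
        (ℕ→ℚ-nonNeg b) (ℕ→ℚ-≤-16* {b} {a} (ℕ.≤-trans b≤m m≤16a)) 16B<δ² (inj₂ (aδ≤-D 0<a)) (jumbled X Z X∩Z=∅))
      where
      a b : ℕ
      a = count X
      b = count Z
      D : ℚ
      D = discrepancy G p X Z
      few-edges : ℕ→ℚ (edgesBetween G X Z) ≤ ℕ→ℚ a * K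
      few-edges = subst (ℕ→ℚ (edgesBetween G X Z) ≤_) (ℕ→ℚ-homo-* a k)
                        (ℕ→ℚ-mono-≤ (Σᶠ-restrict≤ X (degreeInto G Z) k sparse))
      aδ≤-D : 0 ℕ.< a → ℕ→ℚ a * δ ≤ - D
      aδ≤-D 0<a = ≤-by-difference
        ((ℕ→ℚ a * K - ℕ→ℚ (edgesBetween G X Z)) + ℕ→ℚ a * p * (ℕ→ℚ b - ℕ→ℚ m * (+ 1 / 16)))
        (+-mono-≤ (≤⇒0≤- few-edges)
                  (*-nonNeg (*-nonNeg (ℕ→ℚ-nonNeg a) (<⇒≤ 0<p)) (≤⇒0≤- (ℕ→ℚ-/16-≤ {m} {b} m≤16b))))
        (solve 6 (λ e a b p m K → (a :* K :- e) :+ a :* p :* (b :- m :* con (+ 1 / 16))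
                                  := (:- (e :- p :* a :* b)) :- a :* (p :* m :* con (+ 1 / 16) :- K))
                 refl (ℕ→ℚ (edgesBetween G X Z)) (ℕ→ℚ a) (ℕ→ℚ b) p (ℕ→ℚ m) K)

module FactorConstruction {n} (G : Graph n) (k m : ℕ) (U W : Fin n → Bool) (U∩W=∅ : Expansion.Disjointᵇ U W)
  (|U|≡m : Counting.count U ≡ m) (|W|≡m : Counting.count W ≡ m)
  (smallᵁ : Expansion.SmallSetsExpand G k m U W) (smallᵂ : Expansion.SmallSetsExpand G k m W U)
  (large : Expansion.LargeSetsAdjacent G k m) where

  open import Data.Nat
  open import Data.Nat.Properties
  open import Data.Bool using (Bool; true; false; _∧_; _∨_; not)
  open import Data.Bool.Properties using (∨-comm; ∨-identityʳ; ∧-zeroʳ)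
  open import Data.Product using (_×_; _,_; proj₁; proj₂)
  open import Data.Sum using (_⊎_; inj₁; inj₂)
  open import Data.Empty using (⊥-elim)
  open import Relation.Nullary using (yes; no)
  open import Relation.Binary.PropositionalEquality
  open BoolFacts
  open Counting
  open Hall
  open Expansion using (degreeInto)

  InBipartite : Relᵇ n → Set
  InBipartite F = ∀ x y → F x y ≡ true →
    (adj G x y ≡ true) × (((U x ≡ true) × (W y ≡ true)) ⊎ ((W x ≡ true) × (U y ≡ true)))

  record PartialFactor (j : ℕ) : Set where
    field
      F      : Relᵇ n
      F-sym  : ∀ x y → F x y ≡ F y x
      F-sub  : InBipartite F
      F-deg  : ∀ x → U x ∨ W x ≡ true → count (F x) ≡ j

  module Augment {j} (partial : PartialFactor j) (j<k : j < k) where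
    open PartialFactor partial

    R Rᵀ : Relᵇ n
    R x y = U x ∧ W y ∧ adj G x y ∧ not (F x y)
    Rᵀ w u = R u w

    R-intro : ∀ {x y} → U x ≡ true → W y ≡ true → adj G x y ≡ true → F x y ≡ false → R x y ≡ true
    R-intro Ux Wy Gxy Fxy rewrite Ux | Wy | Gxy | Fxy = refl

    R⇒U : ∀ {x y} → R x y ≡ true → U x ≡ true
    R⇒U Rxy = proj₁ (∧-elim Rxy)
    R⇒W : ∀ {x y} → R x y ≡ true → W y ≡ true
    R⇒W {x} Rxy = proj₁ (∧-elim (proj₂ (∧-elim {U x} Rxy)))
    R⇒adj : ∀ {x y} → R x y ≡ true → adj G x y ≡ true
    R⇒adj {x} {y} Rxy = proj₁ (∧-elim (proj₂ (∧-elim {W y} (proj₂ (∧-elim {U x} Rxy)))))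
    R⇒¬F : ∀ {x y} → R x y ≡ true → F x y ≡ false
    R⇒¬F {x} {y} Rxy = not-elim (proj₂ (∧-elim {adj G x y} (proj₂ (∧-elim {W y} (proj₂ (∧-elim {U x} Rxy))))))

    degree-F≤k : ∀ x → U x ∨ W x ≡ true → count (F x) ≤ k
    degree-F≤k x x∈ = subst (_≤ k) (sym (F-deg x x∈)) (<⇒≤ j<k)

    loss≤k : ∀ x → U x ∨ W x ≡ true → ∀ T (Qx : Fin n → Bool) →
      (∀ y → T y ≡ true → adj G x y ≡ true → F x y ≡ false → Qx y ≡ true) → degreeInto G T x ≤ count Qx + k
    loss≤k x x∈ T Qx kept = ≤-trans (count-mono _ _ covered)
      (≤-trans (count-∨ Qx (F x)) (+-monoʳ-≤ (count Qx) (degree-F≤k x x∈)))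
      where
      covered : (λ y → T y ∧ adj G x y) ⊆ᵇ (λ y → Qx y ∨ F x y)
      covered y TGy = bool-cases (F x y) (∨-introʳ (Qx y))
        (λ Fxy → ∨-introˡ (F x y) (kept y (proj₁ (∧-elim TGy)) (proj₂ (∧-elim {T y} TGy)) Fxy))

    lossᵁ : ∀ x → U x ≡ true → degreeInto G W x ≤ count (R x) + k
    lossᵁ x Ux = loss≤k x (∨-introˡ (W x) Ux) W (R x) (λ y Wy Gxy Fxy → R-intro Ux Wy Gxy Fxy)

    lossᵂ : ∀ x → W x ≡ true → degreeInto G U x ≤ count (Rᵀ x) + k
    lossᵂ x Wx = loss≤k x (∨-introʳ (U x) Wx) U (Rᵀ x) λ y Uy Gxy Fxy →
      R-intro Uy Wx (trans (Graph.sym G y x) Gxy) (trans (F-sym y x) Fxy)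

    R⊆G : ∀ x y → R x y ≡ true → (W y ≡ true) × (adj G x y ≡ true)
    R⊆G x y Rxy = R⇒W Rxy , R⇒adj Rxy

    Rᵀ⊆G : ∀ x y → Rᵀ x y ≡ true → (U y ≡ true) × (adj G x y ≡ true)
    Rᵀ⊆G x y Ryx = R⇒U Ryx , trans (Graph.sym G x y) (R⇒adj Ryx)

    module _ (X : Fin n → Bool) (X⊆U : X ⊆ᵇ U) where

      Y Z : Fin n → Bool
      Y = neighbours R X
      Z y = W y ∧ not (Y y)

      Y⊆W : Y ⊆ᵇ W
      Y⊆W y y∈ = let (_ , _ , Rxy) = neighbours-elim R X y y∈ in R⇒W Rxy

      Z⊆W : Z ⊆ᵇ W
      Z⊆W y Zy = proj₁ (∧-elim Zy)

      Z∌Y : ∀ y → Z y ≡ true → Y y ≡ false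
      Z∌Y y Zy = not-elim (proj₂ (∧-elim {W y} Zy))

      |Z|≤|U∖X| : 16 * count Z ≤ m → count Z ≤ count (λ u → U u ∧ not (X u))
      |Z|≤|U∖X| small = ≤-trans (smallᵂ Rᵀ Rᵀ⊆G lossᵂ Z Z⊆W small) (count-mono _ _ N⊆U∖X)
        where
        N⊆U∖X : neighbours Rᵀ Z ⊆ᵇ (λ u → U u ∧ not (X u))
        N⊆U∖X u u∈ with neighbours-elim Rᵀ Z u u∈
        ... | z , Zz , Ruz = ∧-intro (R⇒U Ruz) (not-intro (bool-cases (X u)
              (λ Xu → ⊥-elim (true≢false (neighbours-intro R X u z Xu Ruz) (Z∌Y z Zz))) (λ Xu → Xu)))

      hall-via-complement : 16 * count Z ≤ m → count X ≤ count Y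
      hall-via-complement small = +-cancelʳ-≤ (count (λ u → U u ∧ not (X u))) (count X) (count Y) (begin
        count X + count (λ u → U u ∧ not (X u)) ≡⟨ trans (count-complement X U X⊆U) |U|≡m ⟩
        m                                        ≡⟨ sym (trans (count-complement Y W Y⊆W) |W|≡m) ⟩
        count Y + count Z                        ≤⟨ +-monoʳ-≤ (count Y) (|Z|≤|U∖X| small) ⟩
        count Y + count (λ u → U u ∧ not (X u)) ∎)
        where open ≤-Reasoning

      X-empty : m ≤ 16 * count X → m ≤ 16 * count Z → count X ≡ 0
      X-empty m≤16|X| m≤16|Z| = large X Z (λ x Xx Zx → U∩W=∅ x (X⊆U x Xx) (Z⊆W x Zx)) sparse m≤16|X| m≤16|Z|
        (subst (count Z ≤_) |W|≡m (count-mono Z W Z⊆W))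
        where
        sparse : ∀ x → X x ≡ true → degreeInto G Z x ≤ k
        sparse x Xx = ≤-trans (count-mono _ (F x) ZG⊆F) (degree-F≤k x (∨-introˡ (W x) (X⊆U x Xx)))
          where
          ZG⊆F : (λ y → Z y ∧ adj G x y) ⊆ᵇ F x
          ZG⊆F y ZGy = bool-cases (F x y) (λ Fxy → Fxy) λ Fxy → ⊥-elim (true≢false
            (neighbours-intro R X x y Xx
              (R-intro (X⊆U x Xx) (Z⊆W y (proj₁ (∧-elim ZGy))) (proj₂ (∧-elim {Z y} ZGy)) Fxy))
            (Z∌Y y (proj₁ (∧-elim ZGy))))

    hall-residual : HallCondition R U
    hall-residual X X⊆U with 16 * count X ≤? m | 16 * count (Z X X⊆U) ≤? m
    ... | yes small | _ = smallᵁ R R⊆G lossᵁ X X⊆U small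
    ... | no _ | yes smallᶻ = hall-via-complement X X⊆U smallᶻ
    ... | no largeˣ | no largeᶻ =
      subst (_≤ count (Y X X⊆U)) (sym (X-empty X X⊆U (<⇒≤ (≰⇒> largeˣ)) (<⇒≤ (≰⇒> largeᶻ)))) z≤n

    open PerfectMatching (hall R U W (λ x y Rxy → R⇒U Rxy , R⇒W Rxy)
                               (≤-reflexive (trans |W|≡m (sym |U|≡m))) hall-residual)

    F′ : Relᵇ n
    F′ x y = F x y ∨ (U x ∧ M x y) ∨ (U y ∧ M y x)

    F′-sym : ∀ x y → F′ x y ≡ F′ y x
    F′-sym x y rewrite F-sym x y = cong (F y x ∨_) (∨-comm (U x ∧ M x y) (U y ∧ M y x))

    F′-sub : InBipartite F′
    F′-sub x y F′xy with ∨-elim {F x y} F′xy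
    ... | inj₁ Fxy = F-sub x y Fxy
    ... | inj₂ UM with ∨-elim {U x ∧ M x y} UM
    ...   | inj₁ UMxy = let Rxy = M⊆R x y (proj₂ (∧-elim UMxy)) in R⇒adj Rxy , inj₁ (R⇒U Rxy , R⇒W Rxy)
    ...   | inj₂ UMyx = let Ryx = M⊆R y x (proj₂ (∧-elim UMyx)) in
                        trans (Graph.sym G x y) (R⇒adj Ryx) , inj₂ (R⇒W Ryx , R⇒U Ryx)

    F′-degᵁ : ∀ x → U x ≡ true → count (F′ x) ≡ suc j
    F′-degᵁ x Ux = begin
      count (F′ x)                  ≡⟨ count-cong _ _ F′x≗F∨M ⟩
      count (λ y → F x y ∨ M x y)   ≡⟨ count-∨-disjoint (F x) (M x) disjoint ⟩
      count (F x) + count (M x)     ≡⟨ cong₂ _+_ (F-deg x (∨-introˡ (W x) Ux)) (degᵁ x Ux) ⟩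
      j + 1                         ≡⟨ +-comm j 1 ⟩
      suc j                         ∎
      where
      open ≡-Reasoning
      F′x≗F∨M : ∀ y → F′ x y ≡ F x y ∨ M x y
      F′x≗F∨M y with M y x in Myx
      ... | true = ⊥-elim (U∩W=∅ x Ux (R⇒W (M⊆R y x Myx)))
      ... | false rewrite Ux | ∧-zeroʳ (U y) | ∨-identityʳ (M x y) = refl
      disjoint : ∀ y → F x y ∧ M x y ≡ false
      disjoint y with M x y in Mxy
      ... | true rewrite R⇒¬F (M⊆R x y Mxy) = refl
      ... | false = ∧-zeroʳ (F x y)

    F′-degᵂ : ∀ x → W x ≡ true → U x ≡ false → count (F′ x) ≡ suc j
    F′-degᵂ x Wx Ux = begin
      count (F′ x)                      ≡⟨ count-cong _ _ F′x≗F∨Mᵀ ⟩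
      count (λ y → F x y ∨ M y x)       ≡⟨ count-∨-disjoint (F x) (λ y → M y x) disjoint ⟩
      count (F x) + count (λ y → M y x) ≡⟨ cong₂ _+_ (F-deg x (∨-introʳ (U x) Wx)) (degᵂ x Wx) ⟩
      j + 1                             ≡⟨ +-comm j 1 ⟩
      suc j                             ∎
      where
      open ≡-Reasoning
      F′x≗F∨Mᵀ : ∀ y → F′ x y ≡ F x y ∨ M y x
      F′x≗F∨Mᵀ y with M y x in Myx
      ... | true rewrite Ux | R⇒U (M⊆R y x Myx) = refl
      ... | false rewrite Ux | ∧-zeroʳ (U y) = refl
      disjoint : ∀ y → F x y ∧ M y x ≡ false
      disjoint y with M y x in Myx
      ... | true rewrite F-sym x y | R⇒¬F (M⊆R y x Myx) = refl
      ... | false = ∧-zeroʳ (F x y)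

    augment : PartialFactor (suc j)
    augment = record
      { F = F′ ; F-sym = F′-sym ; F-sub = F′-sub
      ; F-deg = λ x x∈ → bool-cases (U x) (F′-degᵁ x) λ Ux →
          F′-degᵂ x (subst (λ b → b ∨ W x ≡ true) Ux x∈) Ux }

  partialFactor : ∀ j → j ≤ k → PartialFactor j
  partialFactor zero _ = record
    { F = λ _ _ → false ; F-sym = λ _ _ → refl ; F-sub = λ _ _ ()
    ; F-deg = λ _ _ → count-false {n} (λ _ → false) (λ _ → refl) }
  partialFactor (suc j) j<k = Augment.augment (partialFactor j (<⇒≤ j<k)) j<k

module Subsets where

  open import Data.Nat using (ℕ; zero; suc; _+_)
  open import Data.Bool using (Bool; true; false; _∧_)
  open import Data.Fin using (Fin)
  open import Data.Fin.Subset using (Subset; _∈_; _∩_; ∣_∣)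
  open import Data.Vec using ([]; _∷_; lookup; tabulate; sum)
  open import Data.Vec.Properties using (lookup∘tabulate; lookup-zipWith; []=⇒lookup; lookup⇒[]=)
  open import Data.Rational using (ℚ; _≤_; _*_; _-_)
  open import Relation.Binary.PropositionalEquality
  open import Defs using (ℕ→ℚ; Graph; adj; N; e; Bijumbled)
  open Counting
  open Expansion

  ∈⇒lookup : ∀ {n} {x : Fin n} {V : Subset n} → x ∈ V → lookup V x ≡ true
  ∈⇒lookup = []=⇒lookup

  lookup⇒∈ : ∀ {n} {x : Fin n} {V : Subset n} → lookup V x ≡ true → x ∈ V
  lookup⇒∈ {x = x} {V} = lookup⇒[]= x V

  ∣V∣≡count : ∀ {n} (V : Subset n) → ∣ V ∣ ≡ count (lookup V)
  ∣V∣≡count [] = refl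
  ∣V∣≡count (true ∷ V) = cong suc (∣V∣≡count V)
  ∣V∣≡count (false ∷ V) = ∣V∣≡count V

  ∣tabulate∣≡count : ∀ {n} (X : Fin n → Bool) → ∣ tabulate X ∣ ≡ count X
  ∣tabulate∣≡count X = trans (∣V∣≡count (tabulate X)) (count-cong _ _ (lookup∘tabulate X))

  ∣∩N∣≡degreeInto : ∀ {n} (G : Graph n) (V : Subset n) x → ∣ V ∩ N G x ∣ ≡ degreeInto G (lookup V) x
  ∣∩N∣≡degreeInto G V x = trans (∣V∣≡count (V ∩ N G x)) (count-cong _ _ λ y →
    trans (lookup-zipWith _∧_ y V (N G x)) (cong (lookup V y ∧_) (lookup∘tabulate (adj G x) y)))

  sum-tabulate : ∀ {n} (h : Fin n → ℕ) → sum (tabulate h) ≡ Σᶠ h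
  sum-tabulate {zero} h = refl
  sum-tabulate {suc n} h = cong (h Fin.zero +_) (sum-tabulate (λ i → h (Fin.suc i)))

  e≡edgesBetween : ∀ {n} (G : Graph n) (X Y : Fin n → Bool) → e G (tabulate X) (tabulate Y) ≡ edgesBetween G X Y
  e≡edgesBetween G X Y = trans (sum-tabulate summand) (Σᶠ-cong _ _ λ x → begin
    summand x                                              ≡⟨ cong (λ b → restrict b ∣ tabulate Y ∩ N G x ∣)
                                                                   (lookup∘tabulate X x) ⟩
    restrict (X x) ∣ tabulate Y ∩ N G x ∣                  ≡⟨ cong (restrict (X x))
                                                                   (∣∩N∣≡degreeInto G (tabulate Y) x) ⟩
    restrict (X x) (degreeInto G (lookup (tabulate Y)) x)  ≡⟨ cong (restrict (X x)) (count-cong _ _ λ y →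
                                                                   cong (_∧ adj G x y) (lookup∘tabulate Y y)) ⟩
    restrict (X x) (degreeInto G Y x)                      ∎)
    where
    open ≡-Reasoning
    summand : Fin _ → ℕ
    summand x = restrict (lookup (tabulate X) x) ∣ tabulate Y ∩ N G x ∣

  bijumbled⇒jumbled : ∀ {n} (G : Graph n) (p B : ℚ) → Bijumbled G p B → Jumbled G p B
  bijumbled⇒jumbled G p B bijumbled X Y X∩Y=∅ =
    transport (e≡edgesBetween G X Y) (∣tabulate∣≡count X) (∣tabulate∣≡count Y)
      (bijumbled (tabulate X) (tabulate Y) λ x x∈X x∈Y →
        X∩Y=∅ x (trans (sym (lookup∘tabulate X x)) (∈⇒lookup x∈X))
                (trans (sym (lookup∘tabulate Y x)) (∈⇒lookup x∈Y)))
    where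
    Bound : ℕ → ℕ → ℕ → Set
    Bound E a b = (ℕ→ℚ E - p * ℕ→ℚ a * ℕ→ℚ b) * (ℕ→ℚ E - p * ℕ→ℚ a * ℕ→ℚ b) ≤ B * ℕ→ℚ a * ℕ→ℚ b
    transport : ∀ {E a b E′ a′ b′} → E ≡ E′ → a ≡ a′ → b ≡ b′ → Bound E a b → Bound E′ a′ b′
    transport refl refl refl bound = bound

open import Defs hiding (sym)
open import Data.Nat using (_≥_)
import Data.Nat.Properties as ℕ
open import Data.Integer using (+_)
open import Data.Rational using (ℚ; 0ℚ; 1ℚ; _/_; _*_; _≤_; _<_; NonZero; positive; 1/_)
open import Data.Rational.Properties using (*-inverseʳ; <⇒≤; pos⇒nonZero; positive⁻¹; 1/pos⇒pos)
open import Data.Bool using (true; _∨_)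
open import Data.Fin.Subset using (Subset; _∈_; _∩_; ∣_∣)
open import Data.Vec using (lookup)
open import Data.Vec.Properties using (lookup-zipWith)
open import Data.Product using (_×_; _,_; proj₁; proj₂; ∃-syntax)
import Data.Product as Product
import Data.Sum as Sum
open import Relation.Binary.PropositionalEquality using (sym; trans; subst)

open Expansion
open Subsets
open RationalFacts

kFactor-of-bijumbled : ∀ {n} (G : Graph n) (p B : ℚ) (k : ℕ) (U W : Subset n) → 0ℚ < p → 0ℚ ≤ B →
  0ℚ < slack p (ℕ→ℚ ∣ U ∣) k → ℕ→ℚ 16 * B < slack p (ℕ→ℚ ∣ U ∣) k * slack p (ℕ→ℚ ∣ U ∣) k →
  Bijumbled G p B → Disjoint U W → ∣ U ∣ ≡ ∣ W ∣ → MinDegBipAtLeast G U W (p * ℕ→ℚ ∣ U ∣ * (+ 1 / 8)) →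
  KFactor k G U W
kFactor-of-bijumbled G p B k U W 0<p 0≤B 0<δ 16B<δ² bijumbled U∩W=∅ |U|≡|W| (minDegᵁ , minDegᵂ) = record
  { H = F
  ; Hsym = F-sym
  ; Hsub = λ x y Fxy → Product.map₂ (Sum.map both∈ both∈) (F-sub x y Fxy)
  ; Hreg = λ x x∈ → trans (∣tabulate∣≡count (F x))
                          (F-deg x (trans (sym (lookup-zipWith _∨_ x U W)) (∈⇒lookup x∈)))
  }
  where
  U∩W=∅ᵇ : Disjointᵇ (lookup U) (lookup W)
  U∩W=∅ᵇ x Ux Wx = U∩W=∅ x (lookup⇒∈ Ux) (lookup⇒∈ Wx)
  minDegree : ∀ {S T} → (∀ x → x ∈ S → p * ℕ→ℚ ∣ U ∣ * (+ 1 / 8) ≤ ℕ→ℚ ∣ T ∩ N G x ∣) →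
    MinDegree G (lookup S) (lookup T) (p * ℕ→ℚ ∣ U ∣ * (+ 1 / 8))
  minDegree {S} {T} minDeg x Sx = subst (λ d → _ ≤ ℕ→ℚ d) (∣∩N∣≡degreeInto G T x) (minDeg x (lookup⇒∈ Sx))
  both∈ : ∀ {n} {x y : Fin n} {S T} → (lookup S x ≡ true) × (lookup T y ≡ true) → (x ∈ S) × (y ∈ T)
  both∈ = Product.map lookup⇒∈ lookup⇒∈
  jumbled : Jumbled G p B
  jumbled = bijumbled⇒jumbled G p B bijumbled
  open FactorConstruction G k ∣ U ∣ (lookup U) (lookup W) U∩W=∅ᵇ
    (sym (∣V∣≡count U)) (trans (sym (∣V∣≡count W)) (sym |U|≡|W|))
    (small-sets-expand G p B k ∣ U ∣ 0<p 0≤B 0<δ 16B<δ² jumbled U∩W=∅ᵇ (minDegree {U} {W} minDegᵁ))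
    (small-sets-expand G p B k ∣ U ∣ 0<p 0≤B 0<δ 16B<δ² jumbled (λ x Wx Ux → U∩W=∅ᵇ x Ux Wx)
                       (minDegree {W} {U} minDegᵂ))
    (large-sets-adjacent G p B k ∣ U ∣ 0<p 0≤B 0<δ 16B<δ² jumbled)
  open PartialFactor (partialFactor k ℕ.≤-refl)

lemma2p12 : ∀ (k : ℕ) → k ≥ 1 → (c A : ℚ) → 0ℚ < c → 0ℚ < A →
    (p : ℕ → ℚ) → (∀ n → (0ℚ < p n) × (p n < 1ℚ)) →
    TendsToInfinity (λ n → ℕ→ℚ n * p n) →
    ∃[ N₀ ] (∀ (n : ℕ) → n ≥ N₀ → (G : Graph n) →
    Bijumbled G (p n) (A * A * p n * ℕ→ℚ n) →
    ∀ (U W : Subset n) → Disjoint U W → ∣ U ∣ ≡ ∣ W ∣ →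
    c * ℕ→ℚ n ≤ ℕ→ℚ ∣ U ∣ →
    MinDegBipAtLeast G U W (p n * ℕ→ℚ ∣ U ∣ * (+ 1 / 8)) →
    KFactor k G U W)
lemma2p12 k _ c A 0<c _ p 0<p<1 np→∞ = proj₁ (np→∞ M) , λ n n≥N₀ G bijumbled U W U∩W=∅ |U|≡|W| cn≤|U| →
  let 0<p = proj₁ (0<p<1 n)
      (0<δ , 16B<δ²) = slack-from-threshold c c⁻¹ A (p n) (ℕ→ℚ n) (ℕ→ℚ ∣ U ∣) k (*-inverseʳ c) (<⇒≤ 0<c)
                         0≤c⁻¹ (<⇒≤ 0<p) (proj₂ (np→∞ M) n n≥N₀) cn≤|U|
  in kFactor-of-bijumbled G (p n) _ k U W 0<p (*-nonNeg (*-nonNeg (square-nonNeg A) (<⇒≤ 0<p)) (ℕ→ℚ-nonNeg n))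
       0<δ 16B<δ² bijumbled U∩W=∅ |U|≡|W|
  where
  instance
    c≢0 : NonZero c
    c≢0 = pos⇒nonZero c {{positive 0<c}}
  c⁻¹ : ℚ
  c⁻¹ = 1/ c
  0≤c⁻¹ : 0ℚ ≤ c⁻¹
  0≤c⁻¹ = <⇒≤ (positive⁻¹ c⁻¹ {{1/pos⇒pos c {{positive 0<c}}}})
  M : ℚ
  M = threshold c⁻¹ A k
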